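{- Let $S$ be a set of positive integers and $P$ a set of primes such that every element of $S$ is less than every element of $P$. Let $k$ be a field of characteristic zero and let $h: k[S\cup P] \to k[q, x_p : p\text{ prime}]$ be the $k$-algebra homomorphism with $h(q_j) = q^j\prod_{p\text{ prime}} x_p^{\sum_{l\ge1}\lfloor j/p^l\rfloor}$. Then $\ker h$ is generated, as an ideal of $k[S\cup P]$, by $\ker h \cap k[S]$.
   Context: For a set $T$ of positive integers, $k[T]$ denotes the polynomial ring $k[q_j : j \in T]$. -}

module Defs where

open import Level using (Level; _⊔_)
open import Algebra.Bundles using (CommutativeRing)
open import Data.Nat as ℕ using (ℕ; zero; suc; _/_; _≤?_)
open import Data.Nat.Primality using (prime?)
open import Data.List using (List; []; _∷_; _++_; map; concatMap; replicate; filter; upTo; foldr)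
open import Data.List.Properties using (≡-dec)
open import Data.List.Relation.Unary.All using (All)
open import Data.Product using (_×_; _,_; proj₁; proj₂; ∃; Σ-syntax)
open import Data.Sum using (_⊎_)
open import Relation.Nullary using (¬_; yes; no)
open import Relation.Binary.PropositionalEquality using (_≡_)

module _ {c ℓ : Level} (R : CommutativeRing c ℓ) where
  open CommutativeRing R

  natToR : ℕ → Carrier
  natToR zero = 0#
  natToR (suc n) = 1# + natToR n

  IsField : Set (c ⊔ ℓ)
  IsField = (¬ (1# ≈ 0#)) × (∀ x → ¬ (x ≈ 0#) → ∃ λ y → (x * y) ≈ 1#)

  CharZero : Set ℓ
  CharZero = ∀ n → ¬ (natToR (suc n) ≈ 0#)

-- Monomials in variables indexed by ℕ: a monomial is a finite multiset of
-- variable indices, represented by a list (order irrelevant; compared after sorting).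

Mon : Set
Mon = List ℕ

insert : ℕ → List ℕ → List ℕ
insert x [] = x ∷ []
insert x (y ∷ ys) with x ≤? y
... | yes _ = x ∷ y ∷ ys
... | no _ = y ∷ insert x ys

sort : List ℕ → List ℕ
sort [] = []
sort (x ∷ xs) = insert x (sort xs)

-- Exponent of p in j!: Σ_{l ≥ 1} ⌊ j / p^l ⌋ (for p ≥ 2; p = 0 gives 0).

legAux : (fuel j p : ℕ) → ℕ
legAux zero j p = 0
legAux (suc f) j zero = 0
legAux (suc f) j (suc p) = (j / suc p) ℕ.+ legAux f (j / suc p) (suc p)

legendre : ℕ → ℕ → ℕ
legendre j p = legAux j j p

-- Target ring k[q, x_p : p prime] is encoded inside k[x_i : i ∈ ℕ] with
-- q = x_0 and x_p = x_p (p prime, so p ≥ 2; no clash with q).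
-- Image of the variable q_j:  q^j ∏_{p prime} x_p^{legendre j p}
-- (only primes p ≤ j contribute a nonzero exponent).
imageVar : ℕ → Mon
imageVar j = replicate j 0 ++ concatMap (λ p → replicate (legendre j p) p) (filter prime? (upTo (suc j)))

module PolyDefs {c ℓ : Level} (R : CommutativeRing c ℓ) where
  open CommutativeRing R

  Poly : Set c
  Poly = List (Carrier × Mon)

  coeff : Poly → Mon → Carrier
  coeff [] m = 0#
  coeff ((a , m′) ∷ f) m with ≡-dec ℕ._≟_ (sort m′) (sort m)
  ... | yes _ = a + coeff f m
  ... | no _ = coeff f m

  _≈ₚ_ : Poly → Poly → Set ℓ
  f ≈ₚ g = ∀ m → coeff f m ≈ coeff g m

  0ₚ : Poly
  0ₚ = []

  _+ₚ_ : Poly → Poly → Poly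
  f +ₚ g = f ++ g

  _*ₚ_ : Poly → Poly → Poly
  f *ₚ g = concatMap (λ t → map (λ u → (proj₁ t * proj₁ u , proj₂ t ++ proj₂ u)) g) f

  VarsIn : (ℕ → Set) → Poly → Set c
  VarsIn T f = All (λ t → All T (proj₂ t)) f

  h : Poly → Poly
  h = map (λ t → (proj₁ t , concatMap imageVar (proj₂ t)))

  InKer : Poly → Set ℓ
  InKer f = h f ≈ₚ 0ₚ

  InIdealGen : (A : ℕ → Set) → (G : Poly → Set (c ⊔ ℓ)) → Poly → Set (c ⊔ ℓ)
  InIdealGen A G f =
    Σ[ L ∈ List (Poly × Poly) ]
      (All (λ rg → VarsIn A (proj₁ rg) × G (proj₂ rg)) L ×
       (f ≈ₚ foldr (λ rg acc → (proj₁ rg *ₚ proj₂ rg) +ₚ acc) 0ₚ L))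

_∪_ : (ℕ → Set) → (ℕ → Set) → (ℕ → Set)
(A ∪ B) n = A n ⊎ B n

-- A monomial in the variables q_j (j ∈ S ∪ P) factors as u·s with u in the variables indexed by P
-- and s in those indexed by S.  Since h(q_j) contains x_p exactly once when j = p and not at all
-- when j < p, and every element of S is below every element of P, the exponent of x_p in h(u·s)
-- for the largest p occurring in u or u' is its multiplicity in u.  Peeling off largest variables
-- shows that h(u·s) = h(u'·s') forces u = u' and h(s) = h(s').
-- Now let f ∈ ker h and map every monomial m of f to a chosen monomial r of f with h(r) = h(m).
-- Each term a·m differs from a·r by a·u·(s − s'), a multiple of s − s' ∈ ker h ∩ k[S], and the
-- polynomial obtained by replacing every monomial by its representative is h(f) with its monomials
-- renamed, hence zero.

module Submission where

open import Defs
open import Level using (Level; _⊔_)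
open import Algebra.Bundles using (CommutativeRing)
import Algebra.Properties.CommutativeSemigroup as CommutativeSemigroupProperties
import Algebra.Properties.Ring as RingProperties
open import Data.Bool using (Bool; true; false; if_then_else_; _∧_; not; T; T?)
open import Data.Bool.Properties using (∧-identityʳ; ∧-zeroʳ)
open import Data.Nat using (ℕ; zero; suc; 2+; _≤_; _<_; _≟_; _≤?_; _/_; z≤n; s≤s; z<s; nonTrivial⇒n>1)
open import Data.Nat.Properties using (≤-decTotalOrder; ≤-totalOrder; ≤-refl; <-trans; <-≤-trans; <⇒≤; >⇒≢)
open import Data.Nat.DivMod using (n/n≡1; m<n⇒m/n≡0)
open import Data.Nat.Induction using (<-wellFounded)
open import Data.Nat.Primality using (Prime; prime?; prime⇒nonTrivial)
open import Data.List using (List; []; _∷_; [_]; _++_; map; concatMap; replicate; filter; filterᵇ; upTo; foldr; length)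
open import Data.List.Properties
  using (≡-dec; filter-++; filter-none; filter-accept; filter-notAll; length-++; upTo-∷ʳ; concatMap-++;
         map-++; map-∘; ++-conicalˡ; ++-conicalʳ)
open import Data.List.Extrema.Nat using (max; argmax-sel; ⊥≤max; xs≤max)
open import Data.List.Membership.Propositional using (_∈_)
open import Data.List.Membership.Propositional.Properties using (∈-∃++; ∈-++⁻; ∈-map⁺)
open import Data.List.Membership.DecPropositional _≟_ using (_∈?_)
open import Data.List.Relation.Binary.Equality.Propositional using (≋⇒≡)
open import Data.List.Relation.Binary.Permutation.Propositional as ↭
  using (_↭_; ↭-refl; ↭-reflexive; ↭-sym; ↭-trans; ↭-prep; ↭⇒↭ₛ)
open import Data.List.Relation.Binary.Permutation.Propositional.Properties
  using (drop-∷; shift; shifts; ++⁺ˡ; ++⁺ʳ; All-resp-↭; filter-↭; ↭-length)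
open import Data.List.Relation.Unary.All as All using (All; []; _∷_)
open import Data.List.Relation.Unary.All.Properties using (++⁺; ++⁻ˡ; ++⁻ʳ; ¬Any⇒All¬; all-upTo; map⁺)
open import Data.List.Relation.Unary.Any as Any using (Any; here; there)
open import Data.List.Relation.Unary.Sorted.TotalOrder.Properties using (↗↭↗⇒≋)
import Data.List.Sort.InsertionSort.Base ≤-decTotalOrder as InsertionSort
open import Data.List.Sort.InsertionSort.Properties ≤-decTotalOrder
  using () renaming (sort-↭ to insertionSort-↭; sort-↗ to insertionSort-↗)
open import Data.Product using (_×_; _,_; proj₁; proj₂; ∃; ∃₂)
open import Data.Sum using (_⊎_; inj₁; inj₂)
open import Function using (_∘_; id)
open import Function.Bundles using (mk⇔)
open import Induction.WellFounded using (Acc; acc)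
open import Relation.Binary.Core using (_Preserves_⟶_)
open import Relation.Binary.Definitions using (Decidable)
open import Relation.Binary.PropositionalEquality as ≡
  using (_≡_; _≢_; _≗_; refl; sym; cong; cong₂; subst; subst₂; module ≡-Reasoning)
open import Relation.Nullary using (Dec; yes; no; does; contradiction)
open import Relation.Nullary.Decidable using (map′; dec-true; dec-false; does-⇔)

-- Monomials up to rearrangement

sort≗insertionSort : ∀ xs → sort xs ≡ InsertionSort.sort xs
sort≗insertionSort [] = refl
sort≗insertionSort (x ∷ xs) rewrite sort≗insertionSort xs = insert≗ x (InsertionSort.sort xs)
  where
  insert≗ : ∀ x ys → insert x ys ≡ InsertionSort.insert x ys
  insert≗ x [] = refl
  insert≗ x (y ∷ ys) with x ≤? y
  ... | yes x≤y rewrite dec-true (x ≤? y) x≤y = refl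
  ... | no x≰y rewrite dec-false (x ≤? y) x≰y = cong (y ∷_) (insert≗ x ys)

sort-↭ : ∀ xs → sort xs ↭ xs
sort-↭ xs rewrite sort≗insertionSort xs = insertionSort-↭ xs

sort≡⇒↭ : ∀ {xs ys} → sort xs ≡ sort ys → xs ↭ ys
sort≡⇒↭ {xs} {ys} eq = ↭-trans (↭-sym (sort-↭ xs)) (subst (_↭ ys) (sym eq) (sort-↭ ys))

↭⇒sort≡ : ∀ {xs ys} → xs ↭ ys → sort xs ≡ sort ys
↭⇒sort≡ {xs} {ys} xs↭ys rewrite sort≗insertionSort xs | sort≗insertionSort ys =
  ≋⇒≡ (↗↭↗⇒≋ ≤-totalOrder (insertionSort-↗ xs) (insertionSort-↗ ys)
    (↭⇒↭ₛ (↭-trans (insertionSort-↭ xs) (↭-trans xs↭ys (↭-sym (insertionSort-↭ ys))))))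

-- Decided exactly as Defs.coeff compares monomials, so that coeff can be unfolded along it.
_↭?_ : Decidable {A = Mon} _↭_
xs ↭? ys = map′ sort≡⇒↭ ↭⇒sort≡ (≡-dec _≟_ (sort xs) (sort ys))

_↭ᵇ_ : Mon → Mon → Bool
w ↭ᵇ m = does (w ↭? m)

↭ᵇ-respˡ : ∀ {m} → (_↭ᵇ m) Preserves _↭_ ⟶ _≡_
↭ᵇ-respˡ {m} {w} {w'} w↭w' = does-⇔ (mk⇔ (↭-trans (↭-sym w↭w')) (↭-trans w↭w')) (w ↭? m) (w' ↭? m)

↭ᵇ-respʳ : ∀ {w} → (w ↭ᵇ_) Preserves _↭_ ⟶ _≡_
↭ᵇ-respʳ {w} {m} {m'} m↭m' =
  does-⇔ (mk⇔ (λ w↭m → ↭-trans w↭m m↭m') (λ w↭m' → ↭-trans w↭m' (↭-sym m↭m'))) (w ↭? m) (w ↭? m')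

++-cancelˡ : ∀ (xs : Mon) {ys zs} → xs ++ ys ↭ xs ++ zs → ys ↭ zs
++-cancelˡ [] ys↭zs = ys↭zs
++-cancelˡ (x ∷ xs) xxs↭xzs = ++-cancelˡ xs (drop-∷ xxs↭xzs)

∈⇒↭∷ : ∀ {x : ℕ} {xs} → x ∈ xs → ∃ λ ys → xs ↭ x ∷ ys
∈⇒↭∷ {x} x∈xs with ys , zs , refl ← ∈-∃++ x∈xs = ys ++ zs , shift x ys zs

maximum : ∀ xs → xs ≡ [] ⊎ ∃ λ p → p ∈ xs × All (_≤ p) xs
maximum [] = inj₁ refl
maximum (x ∷ xs) = inj₂ (max x xs , max∈ (argmax-sel id x xs) , ⊥≤max x xs ∷ xs≤max x xs)
  where
  max∈ : max x xs ≡ x ⊎ max x xs ∈ xs → max x xs ∈ x ∷ xs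
  max∈ (inj₁ max≡x) = here max≡x
  max∈ (inj₂ max∈xs) = there max∈xs

-- Multiplicities and the image of a monomial under h

-- ℕ arithmetic is opened locally: the ring operations further down reuse the names _+_ and _*_.
module _ where
  open import Data.Nat using (_+_; _*_)
  open import Data.Nat.Properties using (m≤n+m; m≤n⇒m<n∨m≡n; *-zeroʳ; *-distribˡ-+)

  mult : ℕ → List ℕ → ℕ
  mult p xs = length (filter (p ≟_) xs)

  mult-++ : ∀ p xs ys → mult p (xs ++ ys) ≡ mult p xs + mult p ys
  mult-++ p xs ys = ≡.trans (cong length (filter-++ (p ≟_) xs ys)) (length-++ (filter (p ≟_) xs))

  mult-↭ : ∀ p {xs ys} → xs ↭ ys → mult p xs ≡ mult p ys
  mult-↭ p xs↭ys = ↭-length (filter-↭ (p ≟_) xs↭ys)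

  mult-none : ∀ p {xs} → All (p ≢_) xs → mult p xs ≡ 0
  mult-none p p∉xs = cong length (filter-none (p ≟_) p∉xs)

  mult-[self] : ∀ p → mult p [ p ] ≡ 1
  mult-[self] p = cong length (filter-accept (p ≟_) {xs = []} refl)

  mult-[≢] : ∀ p q → p ≢ q → mult p [ q ] ≡ 0
  mult-[≢] p q p≢q = mult-none p (p≢q ∷ [])

  ∈⇒mult>0 : ∀ {p xs} → p ∈ xs → 0 < mult p xs
  ∈⇒mult>0 {p} {x ∷ xs} (here refl) rewrite mult-++ p [ p ] xs | mult-[self] p = s≤s z≤n
  ∈⇒mult>0 {p} {x ∷ xs} (there p∈xs) rewrite mult-++ p [ x ] xs = <-≤-trans (∈⇒mult>0 p∈xs) (m≤n+m _ _)

  mult>0⇒∈ : ∀ {p xs} → 0 < mult p xs → p ∈ xs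
  mult>0⇒∈ {p} {xs} 0<mult with p ∈? xs
  ... | yes p∈xs = p∈xs
  ... | no p∉xs = contradiction (mult-none p (¬Any⇒All¬ xs p∉xs)) (>⇒≢ 0<mult)

  mult-replicate : ∀ p n q → mult p (replicate n q) ≡ n * mult p [ q ]
  mult-replicate p zero q = refl
  mult-replicate p (suc n) q =
    ≡.trans (mult-++ p [ q ] (replicate n q)) (cong (mult p [ q ] +_) (mult-replicate p n q))

  mult-concatMap-replicate : ∀ p (e : ℕ → ℕ) qs → mult p (concatMap (λ q → replicate (e q) q) qs) ≡ e p * mult p qs
  mult-concatMap-replicate p e [] = sym (*-zeroʳ (e p))
  mult-concatMap-replicate p e (q ∷ qs) = begin
    mult p (replicate (e q) q ++ concatMap (λ q → replicate (e q) q) qs)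
      ≡⟨ mult-++ p (replicate (e q) q) _ ⟩
    mult p (replicate (e q) q) + mult p (concatMap (λ q → replicate (e q) q) qs)
      ≡⟨ cong₂ _+_ (≡.trans (mult-replicate p (e q) q) (only-p-counts (p ≟ q))) (mult-concatMap-replicate p e qs) ⟩
    e p * mult p [ q ] + e p * mult p qs
      ≡⟨ *-distribˡ-+ (e p) (mult p [ q ]) (mult p qs) ⟨
    e p * (mult p [ q ] + mult p qs)
      ≡⟨ cong (e p *_) (mult-++ p [ q ] qs) ⟨
    e p * mult p (q ∷ qs) ∎
    where
    open ≡-Reasoning
    only-p-counts : Dec (p ≡ q) → e q * mult p [ q ] ≡ e p * mult p [ q ]
    only-p-counts (yes refl) = refl
    only-p-counts (no p≢q) rewrite mult-[≢] p q p≢q = ≡.trans (*-zeroʳ (e q)) (sym (*-zeroʳ (e p)))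

  mult-filter-prime : ∀ {p} → Prime p → ∀ xs → mult p (filter prime? xs) ≡ mult p xs
  mult-filter-prime pp [] = refl
  mult-filter-prime {p} pp (q ∷ xs) with prime? q
  ... | yes _ = ≡.trans (mult-++ p [ q ] _)
                  (≡.trans (cong (mult p [ q ] +_) (mult-filter-prime pp xs)) (sym (mult-++ p [ q ] xs)))
  ... | no ¬pq = ≡.trans (mult-filter-prime pp xs)
                   (sym (≡.trans (mult-++ p [ q ] xs) (cong (_+ mult p xs) (mult-[≢] p q λ { refl → ¬pq pp }))))

  mult-upTo-≤ : ∀ p n → n ≤ p → mult p (upTo n) ≡ 0
  mult-upTo-≤ p n n≤p = mult-none p (All.map (λ q<n → >⇒≢ (<-≤-trans q<n n≤p)) (all-upTo n))

  mult-upTo-suc-self : ∀ p → mult p (upTo (suc p)) ≡ 1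
  mult-upTo-suc-self p = begin
    mult p (upTo (suc p))          ≡⟨ cong (mult p) (upTo-∷ʳ p) ⟨
    mult p (upTo p ++ [ p ])       ≡⟨ mult-++ p (upTo p) [ p ] ⟩
    mult p (upTo p) + mult p [ p ] ≡⟨ cong₂ _+_ (mult-upTo-≤ p p ≤-refl) (mult-[self] p) ⟩
    1 ∎
    where open ≡-Reasoning

  prime⇒>1 : ∀ {p} → Prime p → 1 < p
  prime⇒>1 {p} pp = nonTrivial⇒n>1 p {{prime⇒nonTrivial pp}}

  legendre-self : ∀ {p} → 1 < p → legendre p p ≡ 1
  legendre-self {2+ k} (s≤s (s≤s z≤n)) = begin
    p / p + legAux (suc k) (p / p) p ≡⟨ cong (λ n → n + legAux (suc k) n p) (n/n≡1 p) ⟩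
    1 + (1 / p + legAux k (1 / p) p) ≡⟨ cong (λ n → 1 + (n + legAux k n p)) (m<n⇒m/n≡0 {1} {p} (s≤s (s≤s z≤n))) ⟩
    1 + legAux k 0 p                 ≡⟨ cong suc (legAux-zero k) ⟩
    1 ∎
    where
    open ≡-Reasoning
    p = 2+ k
    legAux-zero : ∀ fuel → legAux fuel 0 p ≡ 0
    legAux-zero zero = refl
    legAux-zero (suc fuel) = legAux-zero fuel

  mult-imageVar : ∀ {p} → Prime p → ∀ j → mult p (imageVar j) ≡ legendre j p * mult p (upTo (suc j))
  mult-imageVar {p} pp j = begin
    mult p (replicate j 0 ++ concatMap (λ q → replicate (legendre j q) q) (filter prime? (upTo (suc j))))
      ≡⟨ mult-++ p (replicate j 0) _ ⟩
    mult p (replicate j 0) + mult p (concatMap (λ q → replicate (legendre j q) q) (filter prime? (upTo (suc j))))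
      ≡⟨ cong₂ _+_ (≡.trans (mult-replicate p j 0) (cong (j *_) (mult-[≢] p 0 p≢0)))
                   (mult-concatMap-replicate p (λ q → legendre j q) (filter prime? (upTo (suc j)))) ⟩
    j * 0 + legendre j p * mult p (filter prime? (upTo (suc j)))
      ≡⟨ cong₂ _+_ (*-zeroʳ j) (cong (legendre j p *_) (mult-filter-prime pp (upTo (suc j)))) ⟩
    legendre j p * mult p (upTo (suc j)) ∎
    where
    open ≡-Reasoning
    p≢0 : p ≢ 0
    p≢0 = >⇒≢ (<-trans z<s (prime⇒>1 pp))

  mult-imageVar-≤ : ∀ {p} → Prime p → ∀ {j} → j ≤ p → mult p (imageVar j) ≡ mult p [ j ]
  mult-imageVar-≤ {p} pp {j} j≤p with m≤n⇒m<n∨m≡n j≤p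
  ... | inj₁ j<p = begin
    mult p (imageVar j)                  ≡⟨ mult-imageVar pp j ⟩
    legendre j p * mult p (upTo (suc j)) ≡⟨ cong (legendre j p *_) (mult-upTo-≤ p (suc j) j<p) ⟩
    legendre j p * 0                     ≡⟨ *-zeroʳ (legendre j p) ⟩
    0                                    ≡⟨ mult-[≢] p j (>⇒≢ j<p) ⟨
    mult p [ j ] ∎
    where open ≡-Reasoning
  ... | inj₂ refl = begin
    mult p (imageVar p)                  ≡⟨ mult-imageVar pp p ⟩
    legendre p p * mult p (upTo (suc p)) ≡⟨ cong₂ _*_ (legendre-self (prime⇒>1 pp)) (mult-upTo-suc-self p) ⟩
    1                                    ≡⟨ mult-[self] p ⟨
    mult p [ p ] ∎
    where open ≡-Reasoning

  imageMon : Mon → Mon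
  imageMon = concatMap imageVar

  imageMon-++ : ∀ u v → imageMon (u ++ v) ≡ imageMon u ++ imageMon v
  imageMon-++ = concatMap-++ imageVar

  imageMon-↭ : imageMon Preserves _↭_ ⟶ _↭_
  imageMon-↭ ↭.refl = ↭-refl
  imageMon-↭ (↭.prep x u↭v) = ++⁺ˡ (imageVar x) (imageMon-↭ u↭v)
  imageMon-↭ (↭.swap x y u↭v) =
    ↭-trans (shifts (imageVar x) (imageVar y)) (++⁺ˡ (imageVar y) (++⁺ˡ (imageVar x) (imageMon-↭ u↭v)))
  imageMon-↭ (↭.trans u↭w w↭v) = ↭-trans (imageMon-↭ u↭w) (imageMon-↭ w↭v)

  mult-imageMon : ∀ {p} → Prime p → ∀ {v} → All (_≤ p) v → mult p (imageMon v) ≡ mult p v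
  mult-imageMon pp [] = refl
  mult-imageMon {p} pp {j ∷ v} (j≤p ∷ v≤p) = begin
    mult p (imageVar j ++ imageMon v)         ≡⟨ mult-++ p (imageVar j) (imageMon v) ⟩
    mult p (imageVar j) + mult p (imageMon v) ≡⟨ cong₂ _+_ (mult-imageVar-≤ pp j≤p) (mult-imageMon pp v≤p) ⟩
    mult p [ j ] + mult p v                   ≡⟨ mult-++ p [ j ] v ⟨
    mult p (j ∷ v) ∎
    where open ≡-Reasoning

-- Injectivity of h on the variables indexed by P

module PrimeVariables {S P : ℕ → Set} (P-prime : ∀ {p} → P p → Prime p) (S<P : ∀ {s p} → S s → P p → s < p) where
  open import Data.Nat using (_+_)
  open import Data.Nat.Properties using (n<1+n; +-identityʳ; +-mono-<)

  mult-imageMon-top : ∀ {p} → P p → ∀ {u s} → All (_≤ p) u → All S s → mult p (imageMon (u ++ s)) ≡ mult p u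
  mult-imageMon-top {p} Pp {u} {s} u≤p Ss = begin
    mult p (imageMon (u ++ s)) ≡⟨ mult-imageMon (P-prime Pp) (++⁺ u≤p (All.map (λ Sx → <⇒≤ (S<P Sx Pp)) Ss)) ⟩
    mult p (u ++ s)            ≡⟨ mult-++ p u s ⟩
    mult p u + mult p s        ≡⟨ cong (mult p u +_) (mult-none p (All.map (λ Sx → >⇒≢ (S<P Sx Pp)) Ss)) ⟩
    mult p u + 0               ≡⟨ +-identityʳ (mult p u) ⟩
    mult p u ∎
    where open ≡-Reasoning

  top-variable-in-both : ∀ {p u u' s s'} → P p → p ∈ u ++ u' → All (_≤ p) (u ++ u') → All S s → All S s' →
                         imageMon (u ++ s) ↭ imageMon (u' ++ s') → p ∈ u × p ∈ u'
  top-variable-in-both {p} {u} {u'} Pp p∈u++u' u++u'≤p Ss Ss' img = in-both (∈-++⁻ u p∈u++u')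
    where
    balanced : mult p u ≡ mult p u'
    balanced = ≡.trans (sym (mult-imageMon-top Pp (++⁻ˡ u u++u'≤p) Ss))
                       (≡.trans (mult-↭ p img) (mult-imageMon-top Pp (++⁻ʳ u u++u'≤p) Ss'))
    in-both : p ∈ u ⊎ p ∈ u' → p ∈ u × p ∈ u'
    in-both (inj₁ p∈u) = p∈u , mult>0⇒∈ (subst (0 <_) balanced (∈⇒mult>0 p∈u))
    in-both (inj₂ p∈u') = mult>0⇒∈ (subst (0 <_) (sym balanced) (∈⇒mult>0 p∈u')) , p∈u'

  P-part-injective : ∀ {u u' s s'} → All P u → All P u' → All S s → All S s' →
                     imageMon (u ++ s) ↭ imageMon (u' ++ s') → u ↭ u'
  P-part-injective = go (<-wellFounded _)
    where
    go : ∀ {u u' s s'} → Acc _<_ (length u + length u') → All P u → All P u' → All S s → All S s' →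
         imageMon (u ++ s) ↭ imageMon (u' ++ s') → u ↭ u'
    go {u} {u'} {s} {s'} (acc rec) Pu Pu' Ss Ss' img with maximum (u ++ u')
    ... | inj₁ u++u'≡[] = ↭-reflexive (≡.trans (++-conicalˡ u u' u++u'≡[]) (sym (++-conicalʳ u u' u++u'≡[])))
    ... | inj₂ (p , p∈u++u' , u++u'≤p)
      with p∈u , p∈u' ← top-variable-in-both (All.lookup (++⁺ Pu Pu') p∈u++u') p∈u++u' u++u'≤p Ss Ss' img
      with u₁ , u↭pu₁ ← ∈⇒↭∷ p∈u
      with u₁' , u'↭pu₁' ← ∈⇒↭∷ p∈u'
      = ↭-trans u↭pu₁ (↭-trans (↭-prep p (go (rec shorter) (tail u↭pu₁ Pu) (tail u'↭pu₁' Pu') Ss Ss' img₁))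
                                (↭-sym u'↭pu₁'))
      where
      tail : ∀ {v v₁} → v ↭ p ∷ v₁ → All P v → All P v₁
      tail v↭pv₁ Pv = All.tail (All-resp-↭ v↭pv₁ Pv)
      shorter : length u₁ + length u₁' < length u + length u'
      shorter = subst (length u₁ + length u₁' <_) (sym (cong₂ _+_ (↭-length u↭pu₁) (↭-length u'↭pu₁')))
                      (+-mono-< (n<1+n (length u₁)) (n<1+n (length u₁')))
      img₁ : imageMon (u₁ ++ s) ↭ imageMon (u₁' ++ s')
      img₁ = ++-cancelˡ (imageVar p) (↭-trans (imageMon-↭ (++⁺ʳ s (↭-sym u↭pu₁)))
                                              (↭-trans img (imageMon-↭ (++⁺ʳ s' u'↭pu₁'))))

  separate : ∀ {m} → All (S ∪ P) m → ∃₂ λ u s → All P u × All S s × m ↭ u ++ s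
  separate [] = [] , [] , [] , [] , ↭-refl
  separate {x ∷ m} (inj₁ Sx ∷ Vm) with u , s , Pu , Ss , m↭us ← separate Vm =
    u , x ∷ s , Pu , Sx ∷ Ss , ↭-trans (↭-prep x m↭us) (↭-sym (shift x u s))
  separate {x ∷ m} (inj₂ Px ∷ Vm) with u , s , Pu , Ss , m↭us ← separate Vm =
    x ∷ u , s , Px ∷ Pu , Ss , ↭-prep x m↭us

  record CommonPPart (m r : Mon) : Set where
    field
      u s s' : Mon
      Pu : All P u
      Ss : All S s
      Ss' : All S s'
      m↭us : m ↭ u ++ s
      r↭us' : r ↭ u ++ s'
      imageMon-s↭s' : imageMon s ↭ imageMon s'

  common-P-part : ∀ {m r} → All (S ∪ P) m → All (S ∪ P) r → imageMon m ↭ imageMon r → CommonPPart m r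
  common-P-part Vm Vr img
    with u , s , Pu , Ss , m↭us ← separate Vm
    with u' , s' , Pu' , Ss' , r↭u's' ← separate Vr
    = record { u = u ; s = s ; s' = s' ; Pu = Pu ; Ss = Ss ; Ss' = Ss'
             ; m↭us = m↭us ; r↭us' = ↭-trans r↭u's' (++⁺ʳ s' (↭-sym u↭u'))
             ; imageMon-s↭s' = ++-cancelˡ (imageMon u) (subst₂ _↭_ (imageMon-++ u s) (imageMon-++ u s') us↭us') }
    where
    us↭u's' : imageMon (u ++ s) ↭ imageMon (u' ++ s')
    us↭u's' = ↭-trans (imageMon-↭ (↭-sym m↭us)) (↭-trans img (imageMon-↭ r↭u's'))
    u↭u' : u ↭ u'
    u↭u' = P-part-injective Pu Pu' Ss Ss' us↭u's'
    us↭us' : imageMon (u ++ s) ↭ imageMon (u ++ s')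
    us↭us' = ↭-trans us↭u's' (imageMon-↭ (++⁺ʳ s' (↭-sym u↭u')))

-- A monomial of zs with image M, or the junk value [] if there is none.
pick : List Mon → Mon → Mon
pick [] M = []
pick (z ∷ zs) M = if imageMon z ↭ᵇ M then z else pick zs M

pick-resp : ∀ zs → pick zs Preserves _↭_ ⟶ _≡_
pick-resp [] M↭M' = refl
pick-resp (z ∷ zs) M↭M' = cong₂ (if_then z else_) (↭ᵇ-respʳ {imageMon z} M↭M') (pick-resp zs M↭M')

pick-image : ∀ {zs M} → Any (λ z → imageMon z ↭ M) zs → imageMon (pick zs M) ↭ M
pick-image {z ∷ zs} {M} found = choose (imageMon z ↭? M) found
  where
  choose : (d : Dec (imageMon z ↭ M)) → Any (λ z → imageMon z ↭ M) (z ∷ zs) →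
           imageMon (if does d then z else pick zs M) ↭ M
  choose (yes z↦M) _ = z↦M
  choose (no z↦̸M) (here z↦M) = contradiction z↦M z↦̸M
  choose (no _) (there found) = pick-image found

pick-All : ∀ {Q : Mon → Set} {zs} → Q [] → All Q zs → ∀ M → Q (pick zs M)
pick-All Q[] [] M = Q[]
pick-All {Q} {z ∷ zs} Q[] (Qz ∷ Qzs) M = choose (imageMon z ↭ᵇ M)
  where
  choose : ∀ b → Q (if b then z else pick zs M)
  choose true = Qz
  choose false = pick-All Q[] Qzs M

-- Polynomials

module _ {c ℓ : Level} (R : CommutativeRing c ℓ) where
  open CommutativeRing R renaming (refl to ≈-refl; sym to ≈-sym; trans to ≈-trans)
  open PolyDefs R
  open RingProperties ring using (-0#≈0#; -‿+-comm; -1*x≈-x; x∙y⁻¹≈ε⇒x≈y)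
  open CommutativeSemigroupProperties +-commutativeSemigroup using (interchange)
  open import Relation.Binary.Reasoning.Setoid setoid

  _∧ᵖ_ : (Mon → Bool) → (Mon → Bool) → Mon → Bool
  (c ∧ᵖ q) w = c w ∧ q w

  coeffWhere : (Mon → Bool) → Poly → Carrier
  coeffWhere q [] = 0#
  coeffWhere q ((a , w) ∷ f) = (if q w then a else 0#) + coeffWhere q f

  coeff≈coeffWhere : ∀ f m → coeff f m ≈ coeffWhere (_↭ᵇ m) f
  coeff≈coeffWhere [] m = ≈-refl
  coeff≈coeffWhere ((a , w) ∷ f) m with ≡-dec _≟_ (sort w) (sort m)
  ... | yes _ = +-congˡ (coeff≈coeffWhere f m)
  ... | no _ = ≈-trans (coeff≈coeffWhere f m) (≈-sym (+-identityˡ _))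

  coeffWhere-++ : ∀ q f g → coeffWhere q (f ++ g) ≈ coeffWhere q f + coeffWhere q g
  coeffWhere-++ q [] g = ≈-sym (+-identityˡ _)
  coeffWhere-++ q ((a , w) ∷ f) g = ≈-trans (+-congˡ (coeffWhere-++ q f g)) (≈-sym (+-assoc _ _ _))

  coeff-++ : ∀ f g m → coeff (f ++ g) m ≈ coeff f m + coeff g m
  coeff-++ f g m = begin
    coeff (f ++ g) m                            ≈⟨ coeff≈coeffWhere (f ++ g) m ⟩
    coeffWhere (_↭ᵇ m) (f ++ g)                 ≈⟨ coeffWhere-++ (_↭ᵇ m) f g ⟩
    coeffWhere (_↭ᵇ m) f + coeffWhere (_↭ᵇ m) g ≈⟨ +-cong (coeff≈coeffWhere f m) (coeff≈coeffWhere g m) ⟨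
    coeff f m + coeff g m ∎

  coeffWhere-cong : ∀ {q q'} → q ≗ q' → ∀ f → coeffWhere q f ≡ coeffWhere q' f
  coeffWhere-cong q≗q' [] = refl
  coeffWhere-cong q≗q' ((a , w) ∷ f) = cong₂ (λ b x → (if b then a else 0#) + x) (q≗q' w) (coeffWhere-cong q≗q' f)

  coeffWhere-false : ∀ f → coeffWhere (λ _ → false) f ≈ 0#
  coeffWhere-false [] = ≈-refl
  coeffWhere-false ((a , w) ∷ f) = ≈-trans (+-identityˡ _) (coeffWhere-false f)

  coeffWhere-split : ∀ c q f → coeffWhere q f ≈ coeffWhere (c ∧ᵖ q) f + coeffWhere ((not ∘ c) ∧ᵖ q) f
  coeffWhere-split c q [] = ≈-sym (+-identityˡ 0#)
  coeffWhere-split c q ((a , w) ∷ f) =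
    ≈-trans (+-cong (split-term (c w) (q w)) (coeffWhere-split c q f))
            (interchange (if c w ∧ q w then a else 0#) (if not (c w) ∧ q w then a else 0#)
                         (coeffWhere (c ∧ᵖ q) f) (coeffWhere ((not ∘ c) ∧ᵖ q) f))
    where
    split-term : ∀ b b' → (if b' then a else 0#) ≈ (if b ∧ b' then a else 0#) + (if not b ∧ b' then a else 0#)
    split-term true true = ≈-sym (+-identityʳ a)
    split-term false true = ≈-sym (+-identityˡ a)
    split-term true false = ≈-sym (+-identityˡ 0#)
    split-term false false = ≈-sym (+-identityˡ 0#)

  coeffWhere-filter : ∀ c q f → coeffWhere q (filterᵇ (c ∘ proj₂) f) ≈ coeffWhere (c ∧ᵖ q) f
  coeffWhere-filter c q [] = ≈-refl
  coeffWhere-filter c q ((a , w) ∷ f) with c w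
  ... | true = +-congˡ (coeffWhere-filter c q f)
  ... | false = ≈-trans (coeffWhere-filter c q f) (≈-sym (+-identityˡ _))

  coeffWhere-class : ∀ f → f ≈ₚ 0ₚ → ∀ {q} → q Preserves _↭_ ⟶ _≡_ → ∀ m →
                     coeffWhere ((_↭ᵇ m) ∧ᵖ q) f ≈ 0#
  coeffWhere-class f f≈0 {q} q-closed m =
    ≈-trans (reflexive (coeffWhere-cong (λ w → constant-on-class (w ↭? m)) f)) (on-class (q m))
    where
    constant-on-class : ∀ {w} (d : Dec (w ↭ m)) → does d ∧ q w ≡ does d ∧ q m
    constant-on-class (yes w↭m) = q-closed w↭m
    constant-on-class (no _) = refl
    on-class : ∀ b → coeffWhere (λ w → (w ↭ᵇ m) ∧ b) f ≈ 0#
    on-class true = begin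
      coeffWhere (λ w → (w ↭ᵇ m) ∧ true) f ≡⟨ coeffWhere-cong (λ w → ∧-identityʳ (w ↭ᵇ m)) f ⟩
      coeffWhere (_↭ᵇ m) f                 ≈⟨ coeff≈coeffWhere f m ⟨
      coeff f m                            ≈⟨ f≈0 m ⟩
      0# ∎
    on-class false = ≈-trans (reflexive (coeffWhere-cong (λ w → ∧-zeroʳ (w ↭ᵇ m)) f)) (coeffWhere-false f)

  coeffWhere-off-class : ∀ f → f ≈ₚ 0ₚ → ∀ {q} → q Preserves _↭_ ⟶ _≡_ → ∀ m →
                         coeffWhere ((not ∘ (_↭ᵇ m)) ∧ᵖ q) f ≈ coeffWhere q f
  coeffWhere-off-class f f≈0 {q} q-closed m = begin
    coeffWhere ((not ∘ (_↭ᵇ m)) ∧ᵖ q) f                               ≈⟨ +-identityˡ _ ⟨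
    0# + coeffWhere ((not ∘ (_↭ᵇ m)) ∧ᵖ q) f                          ≈⟨ +-congʳ (coeffWhere-class f f≈0 q-closed m) ⟨
    coeffWhere ((_↭ᵇ m) ∧ᵖ q) f + coeffWhere ((not ∘ (_↭ᵇ m)) ∧ᵖ q) f ≈⟨ coeffWhere-split (_↭ᵇ m) q f ⟨
    coeffWhere q f ∎

  -- Strong induction on the number of terms: the class of the first monomial contributes 0
  -- (coeffWhere-class), and the remaining terms again form a polynomial ≈ₚ 0ₚ.
  coeffWhere-≈ₚ0 : ∀ f → f ≈ₚ 0ₚ → ∀ {q} → q Preserves _↭_ ⟶ _≡_ → coeffWhere q f ≈ 0#
  coeffWhere-≈ₚ0 f = go f (<-wellFounded _)
    where
    go : ∀ f → Acc _<_ (length f) → f ≈ₚ 0ₚ → ∀ {q} → q Preserves _↭_ ⟶ _≡_ → coeffWhere q f ≈ 0#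
    go [] _ _ _ = ≈-refl
    go f@((a , m) ∷ _) (acc rec) f≈0 {q} q-closed = begin
      coeffWhere q f            ≈⟨ coeffWhere-off-class f f≈0 q-closed m ⟨
      coeffWhere (off-m ∧ᵖ q) f ≈⟨ coeffWhere-filter off-m q f ⟨
      coeffWhere q rest         ≈⟨ go rest (rec shorter) rest≈0 q-closed ⟩
      0# ∎
      where
      off-m : Mon → Bool
      off-m = not ∘ (_↭ᵇ m)
      rest : Poly
      rest = filterᵇ (off-m ∘ proj₂) f
      rest≈0 : rest ≈ₚ 0ₚ
      rest≈0 M = begin
        coeff rest M                    ≈⟨ coeff≈coeffWhere rest M ⟩
        coeffWhere (_↭ᵇ M) rest         ≈⟨ coeffWhere-filter off-m (_↭ᵇ M) f ⟩
        coeffWhere (off-m ∧ᵖ (_↭ᵇ M)) f ≈⟨ coeffWhere-off-class f f≈0 (↭ᵇ-respˡ {M}) m ⟩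
        coeffWhere (_↭ᵇ M) f            ≈⟨ coeff≈coeffWhere f M ⟨
        coeff f M                       ≈⟨ f≈0 M ⟩
        0# ∎
      shorter : length rest < length f
      shorter = filter-notAll (T? ∘ off-m ∘ proj₂) f (here (subst (T ∘ not) (dec-true (m ↭? m) ↭-refl)))

  negₚ : Poly → Poly
  negₚ = map (λ t → (- proj₁ t , proj₂ t))

  coeffWhere-negₚ : ∀ q f → coeffWhere q (negₚ f) ≈ - coeffWhere q f
  coeffWhere-negₚ q [] = ≈-sym -0#≈0#
  coeffWhere-negₚ q ((a , w) ∷ f) = ≈-trans (+-cong (negate-term (q w)) (coeffWhere-negₚ q f)) (-‿+-comm _ _)
    where
    negate-term : ∀ b → (if b then - a else 0#) ≈ - (if b then a else 0#)
    negate-term true = ≈-refl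
    negate-term false = ≈-sym -0#≈0#

  coeffWhere-resp-≈ₚ : ∀ f g → f ≈ₚ g → ∀ {q} → q Preserves _↭_ ⟶ _≡_ → coeffWhere q f ≈ coeffWhere q g
  coeffWhere-resp-≈ₚ f g f≈g {q} q-closed = x∙y⁻¹≈ε⇒x≈y _ _ (begin
    coeffWhere q f + - coeffWhere q g      ≈⟨ +-congˡ (coeffWhere-negₚ q g) ⟨
    coeffWhere q f + coeffWhere q (negₚ g) ≈⟨ coeffWhere-++ q f (negₚ g) ⟨
    coeffWhere q (f ++ negₚ g)             ≈⟨ coeffWhere-≈ₚ0 (f ++ negₚ g) difference≈0 q-closed ⟩
    0# ∎)
    where
    difference≈0 : (f ++ negₚ g) ≈ₚ 0ₚ
    difference≈0 M = begin
      coeff (f ++ negₚ g) M                              ≈⟨ coeff≈coeffWhere (f ++ negₚ g) M ⟩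
      coeffWhere (_↭ᵇ M) (f ++ negₚ g)                   ≈⟨ coeffWhere-++ (_↭ᵇ M) f (negₚ g) ⟩
      coeffWhere (_↭ᵇ M) f + coeffWhere (_↭ᵇ M) (negₚ g) ≈⟨ +-congˡ (coeffWhere-negₚ (_↭ᵇ M) g) ⟩
      coeffWhere (_↭ᵇ M) f + - coeffWhere (_↭ᵇ M) g      ≈⟨ +-cong (coeff≈coeffWhere f M) (-‿cong (coeff≈coeffWhere g M)) ⟨
      coeff f M + - coeff g M                            ≈⟨ +-congʳ (f≈g M) ⟩
      coeff g M + - coeff g M                            ≈⟨ -‿inverseʳ (coeff g M) ⟩
      0# ∎

  -- Defs.h is definitionally rename imageMon.
  rename : (Mon → Mon) → Poly → Poly
  rename φ = map (λ t → (proj₁ t , φ (proj₂ t)))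

  coeffWhere-rename : ∀ q φ f → coeffWhere q (rename φ f) ≡ coeffWhere (q ∘ φ) f
  coeffWhere-rename q φ [] = refl
  coeffWhere-rename q φ ((a , w) ∷ f) = cong (_ +_) (coeffWhere-rename q φ f)

  rename-cong : ∀ {φ} → φ Preserves _↭_ ⟶ _↭_ → ∀ {f g} → f ≈ₚ g → rename φ f ≈ₚ rename φ g
  rename-cong {φ} φ-resp {f} {g} f≈g M = begin
    coeff (rename φ f) M            ≈⟨ coeff≈coeffWhere (rename φ f) M ⟩
    coeffWhere (_↭ᵇ M) (rename φ f) ≡⟨ coeffWhere-rename (_↭ᵇ M) φ f ⟩
    coeffWhere ((_↭ᵇ M) ∘ φ) f      ≈⟨ coeffWhere-resp-≈ₚ f g f≈g (↭ᵇ-respˡ {M} ∘ φ-resp) ⟩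
    coeffWhere ((_↭ᵇ M) ∘ φ) g      ≡⟨ coeffWhere-rename (_↭ᵇ M) φ g ⟨
    coeffWhere (_↭ᵇ M) (rename φ g) ≈⟨ coeff≈coeffWhere (rename φ g) M ⟨
    coeff (rename φ g) M ∎

  rename-*ₚ : ∀ {φ} → (∀ w w' → φ (w ++ w') ≡ φ w ++ φ w') →
              ∀ f g → rename φ (f *ₚ g) ≡ (rename φ f *ₚ rename φ g)
  rename-*ₚ φ-hom [] g = refl
  rename-*ₚ {φ} φ-hom ((b , w) ∷ f) g =
    ≡.trans (map-++ _ (map _ g) (f *ₚ g)) (cong₂ _++_ (rename-scale g) (rename-*ₚ φ-hom f g))
    where
    rename-scale : ∀ g → rename φ (map (λ u → (b * proj₁ u , w ++ proj₂ u)) g)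
                         ≡ map (λ u → (b * proj₁ u , φ w ++ proj₂ u)) (rename φ g)
    rename-scale [] = refl
    rename-scale ((a , v) ∷ g) = cong₂ _∷_ (cong (b * a ,_) (φ-hom w v)) (rename-scale g)

  coeffWhere-*ₚ-≈ₚ0 : ∀ f {g} → g ≈ₚ 0ₚ → ∀ {q} → q Preserves _↭_ ⟶ _≡_ → coeffWhere q (f *ₚ g) ≈ 0#
  coeffWhere-*ₚ-≈ₚ0 [] g≈0 q-closed = ≈-refl
  coeffWhere-*ₚ-≈ₚ0 ((b , w) ∷ f) {g} g≈0 {q} q-closed = begin
    coeffWhere q (bw*g ++ f *ₚ g)             ≈⟨ coeffWhere-++ q bw*g (f *ₚ g) ⟩
    coeffWhere q bw*g + coeffWhere q (f *ₚ g) ≈⟨ +-cong (coeffWhere-scale g) (coeffWhere-*ₚ-≈ₚ0 f g≈0 q-closed) ⟩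
    b * coeffWhere (q ∘ (w ++_)) g + 0#       ≈⟨ +-congʳ (*-congˡ (coeffWhere-resp-≈ₚ g 0ₚ g≈0 (q-closed ∘ ++⁺ˡ w))) ⟩
    b * 0# + 0#                               ≈⟨ +-identityʳ (b * 0#) ⟩
    b * 0#                                    ≈⟨ zeroʳ b ⟩
    0# ∎
    where
    bw*g : Poly
    bw*g = map (λ u → (b * proj₁ u , w ++ proj₂ u)) g
    coeffWhere-scale : ∀ g → coeffWhere q (map (λ u → (b * proj₁ u , w ++ proj₂ u)) g) ≈ b * coeffWhere (q ∘ (w ++_)) g
    coeffWhere-scale [] = ≈-sym (zeroʳ b)
    coeffWhere-scale ((a , v) ∷ g) = ≈-trans (+-cong (scale-term (q (w ++ v))) (coeffWhere-scale g)) (≈-sym (distribˡ b _ _))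
      where
      scale-term : ∀ t → (if t then b * a else 0#) ≈ b * (if t then a else 0#)
      scale-term true = ≈-refl
      scale-term false = ≈-sym (zeroʳ b)

  *ₚ-≈ₚ0ʳ : ∀ f {g} → g ≈ₚ 0ₚ → (f *ₚ g) ≈ₚ 0ₚ
  *ₚ-≈ₚ0ʳ f g≈0 M = ≈-trans (coeff≈coeffWhere (f *ₚ _) M) (coeffWhere-*ₚ-≈ₚ0 f g≈0 (↭ᵇ-respˡ {M}))

  if-cong : ∀ b {x y} → x ≈ y → (if b then x else 0#) ≈ (if b then y else 0#)
  if-cong true x≈y = x≈y
  if-cong false _ = ≈-refl

  if-cancel : ∀ b {x y} → x + y ≈ 0# → (if b then x else 0#) + (if b then y else 0#) ≈ 0#
  if-cancel true x+y≈0 = x+y≈0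
  if-cancel false _ = +-identityʳ 0#

  combination : List (Poly × Poly) → Poly
  combination = foldr (λ rg acc → (proj₁ rg *ₚ proj₂ rg) +ₚ acc) 0ₚ

  InKer-combination : ∀ L → All (InKer ∘ proj₂) L → InKer (combination L)
  InKer-combination [] [] M = ≈-refl
  InKer-combination ((r , g) ∷ L) (g∈ker ∷ L∈ker) M = begin
    coeff (h (r *ₚ g ++ combination L)) M                ≡⟨ cong (λ p → coeff p M) (map-++ _ (r *ₚ g) (combination L)) ⟩
    coeff (h (r *ₚ g) ++ h (combination L)) M            ≈⟨ coeff-++ (h (r *ₚ g)) (h (combination L)) M ⟩
    coeff (h (r *ₚ g)) M + coeff (h (combination L)) M   ≡⟨ cong (λ p → coeff p M + _) (rename-*ₚ imageMon-++ r g) ⟩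
    coeff (h r *ₚ h g) M + coeff (h (combination L)) M   ≈⟨ +-cong (*ₚ-≈ₚ0ʳ (h r) g∈ker M) (InKer-combination L L∈ker M) ⟩
    0# + 0#                                              ≈⟨ +-identityʳ 0# ⟩
    0# ∎

  idealGen⊆ker : ∀ {A} {G : Poly → Set (c ⊔ ℓ)} → (∀ {g} → G g → InKer g) →
                 ∀ {f} → InIdealGen A G f → InKer f
  idealGen⊆ker G⊆ker {f} (L , L-gen , f≈combination) M =
    ≈-trans (rename-cong imageMon-↭ {f} {combination L} f≈combination M)
            (InKer-combination L (All.map (G⊆ker ∘ proj₂) L-gen) M)

  module _ {S P : ℕ → Set} (P-prime : ∀ {p} → P p → Prime p) (S<P : ∀ {s p} → S s → P p → s < p) where
    open PrimeVariables P-prime S<P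

    binomial : Mon → Mon → Poly
    binomial s s' = (1# , s) ∷ (- 1# , s') ∷ []

    binomial-InKer : ∀ {s s'} → imageMon s ↭ imageMon s' → InKer (binomial s s')
    binomial-InKer {s} {s'} s↦s' M = begin
      coeff (h (binomial s s')) M
        ≈⟨ coeff≈coeffWhere (h (binomial s s')) M ⟩
      (if imageMon s ↭ᵇ M then 1# else 0#) + ((if imageMon s' ↭ᵇ M then - 1# else 0#) + 0#)
        ≈⟨ +-congˡ (+-identityʳ _) ⟩
      (if imageMon s ↭ᵇ M then 1# else 0#) + (if imageMon s' ↭ᵇ M then - 1# else 0#)
        ≡⟨ cong (λ b → (if imageMon s ↭ᵇ M then 1# else 0#) + (if b then - 1# else 0#)) (↭ᵇ-respˡ {M} (↭-sym s↦s')) ⟩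
      (if imageMon s ↭ᵇ M then 1# else 0#) + (if imageMon s ↭ᵇ M then - 1# else 0#)
        ≈⟨ if-cancel (imageMon s ↭ᵇ M) (-‿inverseʳ 1#) ⟩
      0# ∎

    -- a·m = (a·u)·(s − s') + a·r, tested against a class-closed selector q.
    term-decomposition : ∀ {q} → q Preserves _↭_ ⟶ _≡_ → ∀ {m r} (cp : CommonPPart m r) a →
      let open CommonPPart cp in
      coeffWhere q (((a , u) ∷ []) *ₚ binomial s s') + (if q r then a else 0#) ≈ (if q m then a else 0#)
    term-decomposition {q} q-closed {m} {r} cp a = begin
      ((if q (u ++ s) then a * 1# else 0#) + ((if q (u ++ s') then a * - 1# else 0#) + 0#)) + (if q r then a else 0#)
        ≡⟨ cong₂ (λ b b' → ((if b then a * 1# else 0#) + ((if b' then a * - 1# else 0#) + 0#)) + (if q r then a else 0#))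
                 (q-closed (↭-sym m↭us)) (q-closed (↭-sym r↭us')) ⟩
      ((if q m then a * 1# else 0#) + ((if q r then a * - 1# else 0#) + 0#)) + (if q r then a else 0#)
        ≈⟨ +-assoc _ _ _ ⟩
      (if q m then a * 1# else 0#) + (((if q r then a * - 1# else 0#) + 0#) + (if q r then a else 0#))
        ≈⟨ +-cong (if-cong (q m) (*-identityʳ a)) (≈-trans (+-congʳ (+-identityʳ _)) (if-cancel (q r) a*-1+a≈0)) ⟩
      (if q m then a else 0#) + 0#
        ≈⟨ +-identityʳ _ ⟩
      (if q m then a else 0#) ∎
      where
      open CommonPPart cp
      a*-1+a≈0 : a * - 1# + a ≈ 0#
      a*-1+a≈0 = ≈-trans (+-congʳ (≈-trans (*-comm a (- 1#)) (-1*x≈-x a))) (-‿inverseˡ a)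

    Generator : Poly × Poly → Set (c ⊔ ℓ)
    Generator rg = VarsIn (S ∪ P) (proj₁ rg) × (VarsIn S (proj₂ rg) × InKer (proj₂ rg))

    Decomposition : (Mon → Mon) → Poly → Set (c ⊔ ℓ)
    Decomposition ρ f = ∃ λ L → All Generator L ×
      (∀ {q} → q Preserves _↭_ ⟶ _≡_ → coeffWhere q f ≈ coeffWhere q (combination L) + coeffWhere q (rename ρ f))

    decompose : ∀ (ρ : Mon → Mon) f → All (λ t → CommonPPart (proj₂ t) (ρ (proj₂ t))) f → Decomposition ρ f
    decompose ρ [] [] = [] , [] , λ _ → ≈-sym (+-identityˡ 0#)
    decompose ρ ((a , m) ∷ f) (cp ∷ cps) with L , L-gen , f≈ ← decompose ρ f cps =
      (((a , u) ∷ [] , binomial s s') ∷ L) ,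
      ((All.map inj₂ Pu ∷ []) , (Ss ∷ Ss' ∷ []) , binomial-InKer {s} {s'} imageMon-s↭s') ∷ L-gen ,
      λ {q} q-closed → begin
        (if q m then a else 0#) + coeffWhere q f
          ≈⟨ +-cong (≈-sym (term-decomposition q-closed cp a)) (f≈ q-closed) ⟩
        (coeffWhere q X + (if q (ρ m) then a else 0#)) + (coeffWhere q (combination L) + coeffWhere q (rename ρ f))
          ≈⟨ interchange (coeffWhere q X) _ _ _ ⟩
        (coeffWhere q X + coeffWhere q (combination L)) + ((if q (ρ m) then a else 0#) + coeffWhere q (rename ρ f))
          ≈⟨ +-congʳ (coeffWhere-++ q X (combination L)) ⟨
        coeffWhere q (X ++ combination L) + coeffWhere q (rename ρ ((a , m) ∷ f)) ∎
      where
      open CommonPPart cp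
      X : Poly
      X = ((a , u) ∷ []) *ₚ binomial s s'

    decomposition⇒idealGen : ∀ {ρ f} → rename ρ f ≈ₚ 0ₚ → Decomposition ρ f →
                             InIdealGen (S ∪ P) (λ g → VarsIn S g × InKer g) f
    decomposition⇒idealGen {ρ} {f} ρf≈0 (L , L-gen , f≈) = L , L-gen , λ M → begin
      coeff f M                                                            ≈⟨ coeff≈coeffWhere f M ⟩
      coeffWhere (_↭ᵇ M) f                                                 ≈⟨ f≈ (↭ᵇ-respˡ {M}) ⟩
      coeffWhere (_↭ᵇ M) (combination L) + coeffWhere (_↭ᵇ M) (rename ρ f) ≈⟨ +-congˡ (coeffWhere-≈ₚ0 (rename ρ f) ρf≈0 (↭ᵇ-respˡ {M})) ⟩
      coeffWhere (_↭ᵇ M) (combination L) + 0#                              ≈⟨ +-identityʳ _ ⟩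
      coeffWhere (_↭ᵇ M) (combination L)                                   ≈⟨ coeff≈coeffWhere (combination L) M ⟨
      coeff (combination L) M ∎

    ker⊆idealGen : ∀ f → VarsIn (S ∪ P) f → InKer f → InIdealGen (S ∪ P) (λ g → VarsIn S g × InKer g) f
    ker⊆idealGen f Vf f∈ker = decomposition⇒idealGen {ρ} {f} ρf≈0 (decompose ρ f common)
      where
      Ms : List Mon
      Ms = map proj₂ f
      ρ : Mon → Mon
      ρ = pick Ms ∘ imageMon
      ρf≈0 : rename ρ f ≈ₚ 0ₚ
      ρf≈0 M = ≈-trans (reflexive (cong (λ g → coeff g M) (map-∘ f)))
                       (rename-cong (↭-reflexive ∘ pick-resp Ms) {h f} {0ₚ} f∈ker M)
      common : All (λ t → CommonPPart (proj₂ t) (ρ (proj₂ t))) f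
      common = All.tabulate λ {t} t∈f →
        common-P-part (All.lookup Vf t∈f) (pick-All {All (S ∪ P)} {Ms} [] (map⁺ Vf) (imageMon (proj₂ t)))
          (↭-sym (pick-image (Any.map (λ m≡z → ↭-reflexive (cong imageMon (sym m≡z))) (∈-map⁺ proj₂ t∈f))))

lemma10 : {c ℓ : Level} (R : CommutativeRing c ℓ) → IsField R → CharZero R →
    (S P : ℕ → Set) → (∀ s → S s → 1 ≤ s) → (∀ p → P p → Prime p) →
    (∀ s p → S s → P p → s < p) →
    let open PolyDefs R in
    ∀ (f : Poly) → VarsIn (S ∪ P) f →
      (InKer f → InIdealGen (S ∪ P) (λ g → VarsIn S g × InKer g) f) ×
      (InIdealGen (S ∪ P) (λ g → VarsIn S g × InKer g) f → InKer f)
lemma10 R _ _ S P _ P-prime S<P f Vf =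
  ker⊆idealGen R (P-prime _) (S<P _ _) f Vf , idealGen⊆ker R proj₂ {f}
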